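{- For every integer $k\ge 1$, the complete graph $K_{2k+1}$ has a $3$-edge-coloring that is quasi-majority and neighbor sum distinguishing, in which exactly $k$ vertices are each incident to exactly $k-1$ edges of color $2$ and the remaining $k+1$ vertices are each incident to exactly $k$ edges of color $2$.
   Context: A $k$-edge-coloring of a graph $G$ is any map $c:E(G)\to[k]$ (adjacent edges may receive the same color). It induces $\sigma_c(v)=\sum_{u\in N(v)}c(vu)$. The coloring is neighbor sum distinguishing if $\sigma_c(u)\ne\sigma_c(v)$ for every edge $uv$, and quasi-majority if every vertex $v$ is incident to at most $\lceil d(v)/2\rceil$ edges of each color. -}

module Defs where

open import Data.Nat using (ℕ; suc; _+_; _*_; _≤_; _∸_; ⌈_/2⌉)
open import Data.Nat.Properties using (_≟_)
open import Data.Fin using (Fin)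
open import Data.Fin.Properties as FinP using ()
open import Data.Fin.Subset using (Subset; _∈_; _∉_; ∣_∣)
open import Data.List using (List; filter; length; map; allFin)
open import Data.Nat.ListAction using (sum)
open import Data.Product using (_×_; ∃)
open import Relation.Nullary using (¬_)
open import Relation.Nullary.Decidable using (¬?)
open import Relation.Binary.PropositionalEquality using (_≡_; _≢_)

-- The complete graph K_n on vertex set Fin n: u and v are adjacent iff u ≢ v.
-- An edge coloring of K_n is given by a symmetric function on ordered pairs;
-- its values on the diagonal are irrelevant (never used).
record EdgeColoring (n k : ℕ) : Set where
  field
    col   : Fin n → Fin n → ℕ
    sym   : ∀ u v → u ≢ v → col u v ≡ col v u
    range : ∀ u v → u ≢ v → (1 ≤ col u v) × (col u v ≤ k)
open EdgeColoring public

nbrs : ∀ {n} → Fin n → List (Fin n)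
nbrs {n} v = filter (λ u → ¬? (u FinP.≟ v)) (allFin n)

degree : ∀ {n} → Fin n → ℕ
degree v = length (nbrs v)

σ : ∀ {n k} → EdgeColoring n k → Fin n → ℕ
σ c v = sum (map (λ u → col c v u) (nbrs v))

colorCount : ∀ {n k} → EdgeColoring n k → Fin n → ℕ → ℕ
colorCount c v i = length (filter (λ u → col c v u ≟ i) (nbrs v))

NeighborSumDistinguishing : ∀ {n k} → EdgeColoring n k → Set
NeighborSumDistinguishing {n} c = ∀ (u v : Fin n) → u ≢ v → σ c u ≢ σ c v

QuasiMajority : ∀ {n k} → EdgeColoring n k → Set
QuasiMajority {n} c = ∀ (v : Fin n) (i : ℕ) → colorCount c v i ≤ ⌈ degree v /2⌉

-- Number the vertices 0, …, 2k and color the edge uv by 2 if u + v is even, by 1 if u + v is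
-- odd and below 2k, and by 3 if it is odd and above 2k.  As u runs over all vertices, v + u runs
-- over the window v, …, v + 2k, where the term u = v has the even sum 2v.  Counting parities in
-- the window, vertex 2t sees colors 1, 2, 3 exactly k − t, k, t times and vertex 2t + 1 sees
-- them k − t, k − 1, t + 1 times.  Hence σ(v) = 3k + v separates all vertices, no color occurs
-- more than k = ⌈2k/2⌉ times at a vertex, and S is the set of odd vertices.
module Submission where

open import Defs
open import Data.Nat using (ℕ; suc; _+_; _*_; _∸_; _≤_)
open import Data.Fin using (Fin)
open import Data.Fin.Subset using (Subset; _∈_; _∉_; ∣_∣)
open import Data.Product using (Σ; _×_)
open import Relation.Binary.PropositionalEquality using (_≡_)

open import Data.Bool using (Bool; true; false; if_then_else_; not)
open import Data.Bool.Properties using (not-involutive)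
open import Data.Fin using (toℕ) renaming (zero to fzero; suc to fsuc)
open import Data.Fin.Properties using (_≟_; toℕ-injective; toℕ≤pred[n])
open import Data.List using (List; []; _∷_; map; filter; length; applyUpTo; tabulate; allFin)
open import Data.List.Properties using (map-tabulate)
open import Data.Nat using (zero; z≤n; s≤s)
open import Data.Nat.GeneralisedArithmetic using (iterate)
open import Data.Nat.ListAction using (sum)
open import Data.Nat.Properties
  using (+-suc; +-assoc; +-comm; +-identityʳ; +-cancelʳ-≡; +-cancelˡ-≡;
         ≤-pred; ≤-refl; m≤m+n; m≤n+m; n≤1+n; +-monoʳ-≤; n≡⌈n+n/2⌉)
  renaming (_≟_ to _≟ℕ_)
open import Data.Nat.Tactic.RingSolver using (solve-∀)
open import Data.Product using (_,_)
open import Data.Vec using ([]; _∷_; lookup)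
open import Data.Empty using (⊥-elim)
open import Data.Vec.Properties using ([]=⇒lookup; lookup⇒[]=)
open import Function using (_∘_; const)
open import Relation.Nullary using (does; ¬?)
open import Relation.Unary using (Pred; Decidable)
open import Relation.Binary.PropositionalEquality
  using (refl; trans; cong; cong₂; subst; _≗_; module ≡-Reasoning)
  renaming (sym to ≡-sym)

sum-map-const1≡length : ∀ {a} {A : Set a} (xs : List A) → sum (map (const 1) xs) ≡ length xs
sum-map-const1≡length []       = refl
sum-map-const1≡length (_ ∷ xs) = cong suc (sum-map-const1≡length xs)

length-filter≡sum-indicator : ∀ {a p} {A : Set a} {P : Pred A p} (P? : Decidable P) xs →
  length (filter P? xs) ≡ sum (map (λ x → if does (P? x) then 1 else 0) xs)
length-filter≡sum-indicator P? []       = refl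
length-filter≡sum-indicator P? (x ∷ xs) with does (P? x)
... | true  = cong suc (length-filter≡sum-indicator P? xs)
... | false = length-filter≡sum-indicator P? xs

applyUpTo-cong : ∀ {f g : ℕ → ℕ} → f ≗ g → ∀ n → applyUpTo f n ≡ applyUpTo g n
applyUpTo-cong f≗g zero    = refl
applyUpTo-cong f≗g (suc n) = cong₂ _∷_ (f≗g 0) (applyUpTo-cong (f≗g ∘ suc) n)

tabulate-∘toℕ : ∀ n (f : ℕ → ℕ) → tabulate {n = n} (f ∘ toℕ) ≡ applyUpTo f n
tabulate-∘toℕ zero    f = refl
tabulate-∘toℕ (suc n) f = cong (f 0 ∷_) (tabulate-∘toℕ n (f ∘ suc))

zeroAt : ∀ {n} → Fin n → (Fin n → ℕ) → Fin n → ℕ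
zeroAt v f u = if does (u ≟ v) then 0 else f u

sum-filter-≢ : ∀ {n} (f : Fin n → ℕ) v xs →
  sum (map f (filter (λ u → ¬? (u ≟ v)) xs)) ≡ sum (map (zeroAt v f) xs)
sum-filter-≢ f v []       = refl
sum-filter-≢ f v (u ∷ xs) with does (u ≟ v)
... | true  = sum-filter-≢ f v xs
... | false = cong (f u +_) (sum-filter-≢ f v xs)

sum-tabulate-zeroAt : ∀ {n} (f : Fin n → ℕ) v →
  sum (tabulate (zeroAt v f)) + f v ≡ sum (tabulate f)
sum-tabulate-zeroAt f fzero    = +-comm (sum (tabulate (f ∘ fsuc))) (f fzero)
sum-tabulate-zeroAt f (fsuc v) = trans (+-assoc (f fzero) _ (f (fsuc v)))
  (cong (f fzero +_) (sum-tabulate-zeroAt (f ∘ fsuc) v))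

sum-nbrs : ∀ {n} (f : Fin n → ℕ) v → sum (map f (nbrs v)) + f v ≡ sum (tabulate f)
sum-nbrs {n} f v = begin
  sum (map f (nbrs v)) + f v
    ≡⟨ cong (_+ f v) (sum-filter-≢ f v (allFin n)) ⟩
  sum (map (zeroAt v f) (allFin n)) + f v
    ≡⟨ cong (λ xs → sum xs + f v) (map-tabulate (λ u → u) (zeroAt v f)) ⟩
  sum (tabulate (zeroAt v f)) + f v
    ≡⟨ sum-tabulate-zeroAt f v ⟩
  sum (tabulate f) ∎
  where open ≡-Reasoning

-- edgeColor k s is 2 for even s, 1 for odd s < 2k and 3 for odd s > 2k.
edgeColor : ℕ → ℕ → ℕ
edgeColor k       zero          = 2
edgeColor zero    (suc zero)    = 3
edgeColor (suc k) (suc zero)    = 1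
edgeColor zero    (suc (suc s)) = edgeColor zero s
edgeColor (suc k) (suc (suc s)) = edgeColor k s

edgeColor-range : ∀ k s → 1 ≤ edgeColor k s × edgeColor k s ≤ 3
edgeColor-range k       zero          = s≤s z≤n , s≤s (s≤s z≤n)
edgeColor-range zero    (suc zero)    = s≤s z≤n , ≤-refl
edgeColor-range (suc k) (suc zero)    = s≤s z≤n , s≤s z≤n
edgeColor-range zero    (suc (suc s)) = edgeColor-range zero s
edgeColor-range (suc k) (suc (suc s)) = edgeColor-range k s

edgeColor-double : ∀ k m → edgeColor k (m + m) ≡ 2
edgeColor-double k zero    = refl
edgeColor-double zero    (suc m) rewrite +-suc m m = edgeColor-double zero m
edgeColor-double (suc k) (suc m) rewrite +-suc m m = edgeColor-double k m

edgeColor-shift : ∀ t k s → edgeColor (t + k) (t + t + s) ≡ edgeColor k s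
edgeColor-shift zero    k s = refl
edgeColor-shift (suc t) k s rewrite +-suc t t = edgeColor-shift t k s

coloring : ∀ k → EdgeColoring (suc (2 * k)) 3
coloring k = record
  { col   = λ u v → edgeColor k (toℕ u + toℕ v)
  ; sym   = λ u v _ → cong (edgeColor k) (+-comm (toℕ u) (toℕ v))
  ; range = λ u v _ → edgeColor-range k (toℕ u + toℕ v)
  }

+-regroup : ∀ a b x r → a + (b + (x + r)) ≡ a + b + x + r
+-regroup = solve-∀

sum-colors-below : ∀ (φ : ℕ → ℕ) d n →
  sum (applyUpTo (φ ∘ edgeColor d) (d + d + n)) ≡
  d * (φ 2 + φ 1) + sum (applyUpTo (φ ∘ edgeColor 0) n)
sum-colors-below φ zero    n = refl
sum-colors-below φ (suc d) n rewrite +-suc d d | sum-colors-below φ d n =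
  +-regroup (φ 2) (φ 1) _ _

sum-colors-above : ∀ (φ : ℕ → ℕ) t n →
  sum (applyUpTo (φ ∘ edgeColor 0) (t + t + n)) ≡
  t * (φ 2 + φ 3) + sum (applyUpTo (φ ∘ edgeColor 0) n)
sum-colors-above φ zero    n = refl
sum-colors-above φ (suc t) n rewrite +-suc t t | sum-colors-above φ t n =
  +-regroup (φ 2) (φ 3) _ _

data VertexClass : ℕ → ℕ → Set where
  even : ∀ t d → VertexClass (t + d) (t + t)
  odd  : ∀ t d → VertexClass (t + suc d) (suc (t + t))

VertexClass-suc₂ : ∀ {k m} → VertexClass k m → VertexClass (suc k) (suc (suc m))
VertexClass-suc₂ (even t d) =
  subst (VertexClass (suc (t + d))) (cong suc (+-suc t t)) (even (suc t) d)
VertexClass-suc₂ (odd t d) =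
  subst (VertexClass (suc (t + suc d))) (cong (suc ∘ suc) (+-suc t t)) (odd (suc t) d)

classify : ∀ k m → m ≤ k + k → VertexClass k m
classify k       zero          _  = even 0 k
classify zero    (suc m)       ()
classify (suc k) (suc zero)    _  = odd 0 k
classify (suc k) (suc (suc m)) le =
  VertexClass-suc₂ (classify k m (≤-pred (subst (suc m ≤_) (+-suc k k) (≤-pred le))))

edgeCount : ∀ {k m} → VertexClass k m → ℕ → ℕ
edgeCount (even t d) 1 = d
edgeCount (even t d) 2 = t + d
edgeCount (even t d) 3 = t
edgeCount (odd t d)  1 = suc d
edgeCount (odd t d)  2 = t + d
edgeCount (odd t d)  3 = suc t
edgeCount _          _ = 0

-- σ, the degree and the color counts at a vertex are the instances φ = id, const 1 and
-- indicator i of this sum of φ over its edge colors.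
profileSum : ∀ {k m} → VertexClass k m → (ℕ → ℕ) → ℕ
profileSum cl φ = edgeCount cl 1 * φ 1 + edgeCount cl 2 * φ 2 + edgeCount cl 3 * φ 3

windowSum : (ℕ → ℕ) → ℕ → ℕ → ℕ
windowSum φ k m = sum (applyUpTo (λ s → φ (edgeColor k (m + s))) (suc (2 * k)))

windowSum-profile : ∀ φ {k m} (cl : VertexClass k m) →
  windowSum φ k m ≡ φ 2 + profileSum cl φ
windowSum-profile φ (even t d) = begin
  windowSum φ (t + d) (t + t)
    ≡⟨ cong sum (applyUpTo-cong (cong φ ∘ edgeColor-shift t d) (suc (2 * (t + d)))) ⟩
  sum (applyUpTo (φ ∘ edgeColor d) (suc (2 * (t + d))))
    ≡⟨ cong (sum ∘ applyUpTo (φ ∘ edgeColor d)) (length-split t d) ⟩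
  sum (applyUpTo (φ ∘ edgeColor d) (d + d + (t + t + 1)))
    ≡⟨ sum-colors-below φ d _ ⟩
  d * (φ 2 + φ 1) + sum (applyUpTo (φ ∘ edgeColor 0) (t + t + 1))
    ≡⟨ cong (d * (φ 2 + φ 1) +_) (sum-colors-above φ t 1) ⟩
  d * (φ 2 + φ 1) + (t * (φ 2 + φ 3) + (φ 2 + 0))
    ≡⟨ collect (φ 1) (φ 2) (φ 3) t d ⟩
  φ 2 + profileSum (even t d) φ ∎
  where
  open ≡-Reasoning
  length-split : ∀ t d → suc (2 * (t + d)) ≡ d + d + (t + t + 1)
  length-split = solve-∀
  collect : ∀ a b c t d →
    d * (b + a) + (t * (b + c) + (b + 0)) ≡ b + (d * a + (t + d) * b + t * c)
  collect = solve-∀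
-- Prepending φ 2 = φ (edgeColor (suc d) 0) turns the window into one of edgeColor (suc d) from 0.
windowSum-profile φ (odd t d) = +-cancelˡ-≡ (φ 2) _ _ (begin
  φ 2 + windowSum φ (t + suc d) (suc (t + t))
    ≡⟨ cong (λ xs → φ 2 + sum xs) (applyUpTo-cong (cong φ ∘ shift) (suc (2 * (t + suc d)))) ⟩
  sum (applyUpTo (φ ∘ edgeColor (suc d)) (suc (suc (2 * (t + suc d)))))
    ≡⟨ cong (sum ∘ applyUpTo (φ ∘ edgeColor (suc d))) (length-split t d) ⟩
  sum (applyUpTo (φ ∘ edgeColor (suc d)) (suc d + suc d + (t + t + 2)))
    ≡⟨ sum-colors-below φ (suc d) _ ⟩
  suc d * (φ 2 + φ 1) + sum (applyUpTo (φ ∘ edgeColor 0) (t + t + 2))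
    ≡⟨ cong (suc d * (φ 2 + φ 1) +_) (sum-colors-above φ t 2) ⟩
  suc d * (φ 2 + φ 1) + (t * (φ 2 + φ 3) + (φ 2 + (φ 3 + 0)))
    ≡⟨ collect (φ 1) (φ 2) (φ 3) t d ⟩
  φ 2 + (φ 2 + profileSum (odd t d) φ) ∎)
  where
  open ≡-Reasoning
  shift : ∀ s → edgeColor (t + suc d) (suc (t + t) + s) ≡ edgeColor (suc d) (suc s)
  shift s = trans (cong (edgeColor (t + suc d)) (≡-sym (+-suc (t + t) s)))
                  (edgeColor-shift t (suc d) (suc s))
  length-split : ∀ t d → suc (suc (2 * (t + suc d))) ≡ suc d + suc d + (t + t + 2)
  length-split = solve-∀
  collect : ∀ a b c t d →
    suc d * (b + a) + (t * (b + c) + (b + (c + 0))) ≡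
    b + (b + (suc d * a + (t + d) * b + suc t * c))
  collect = solve-∀

profileSum-id : ∀ {k m} (cl : VertexClass k m) → profileSum cl (λ x → x) ≡ 3 * k + m
profileSum-id (even t d) = sum-even t d
  where
  sum-even : ∀ t d → d * 1 + (t + d) * 2 + t * 3 ≡ 3 * (t + d) + (t + t)
  sum-even = solve-∀
profileSum-id (odd t d) = sum-odd t d
  where
  sum-odd : ∀ t d → suc d * 1 + (t + d) * 2 + suc t * 3 ≡ 3 * (t + suc d) + suc (t + t)
  sum-odd = solve-∀

profileSum-const1 : ∀ {k m} (cl : VertexClass k m) → profileSum cl (const 1) ≡ k + k
profileSum-const1 (even t d) = count-even t d
  where
  count-even : ∀ t d → d * 1 + (t + d) * 1 + t * 1 ≡ t + d + (t + d)
  count-even = solve-∀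
profileSum-const1 (odd t d) = count-odd t d
  where
  count-odd : ∀ t d → suc d * 1 + (t + d) * 1 + suc t * 1 ≡ t + suc d + (t + suc d)
  count-odd = solve-∀

dot-e₁ : ∀ a b c → a * 1 + b * 0 + c * 0 ≡ a
dot-e₁ = solve-∀

dot-e₂ : ∀ a b c → a * 0 + b * 1 + c * 0 ≡ b
dot-e₂ = solve-∀

dot-e₃ : ∀ a b c → a * 0 + b * 0 + c * 1 ≡ c
dot-e₃ = solve-∀

dot-0 : ∀ a b c → a * 0 + b * 0 + c * 0 ≡ 0
dot-0 = solve-∀

indicator : ℕ → ℕ → ℕ
indicator i x = if does (x ≟ℕ i) then 1 else 0

profileSum-indicator : ∀ {k m} (cl : VertexClass k m) i →
  profileSum cl (indicator i) ≡ edgeCount cl i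
profileSum-indicator cl 1 = dot-e₁ (edgeCount cl 1) (edgeCount cl 2) (edgeCount cl 3)
profileSum-indicator cl 2 = dot-e₂ (edgeCount cl 1) (edgeCount cl 2) (edgeCount cl 3)
profileSum-indicator cl 3 = dot-e₃ (edgeCount cl 1) (edgeCount cl 2) (edgeCount cl 3)
profileSum-indicator (even t d) 0 = dot-0 d (t + d) t
profileSum-indicator (odd t d)  0 = dot-0 (suc d) (t + d) (suc t)
profileSum-indicator (even t d) (suc (suc (suc (suc _)))) = dot-0 d (t + d) t
profileSum-indicator (odd t d)  (suc (suc (suc (suc _)))) = dot-0 (suc d) (t + d) (suc t)

edgeCount-≤ : ∀ {k m} (cl : VertexClass k m) i → edgeCount cl i ≤ k
edgeCount-≤ (even t d) 0 = z≤n
edgeCount-≤ (even t d) 1 = m≤n+m d t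
edgeCount-≤ (even t d) 2 = ≤-refl
edgeCount-≤ (even t d) 3 = m≤m+n t d
edgeCount-≤ (even t d) (suc (suc (suc (suc _)))) = z≤n
edgeCount-≤ (odd t d)  0 = z≤n
edgeCount-≤ (odd t d)  1 = m≤n+m (suc d) t
edgeCount-≤ (odd t d)  2 = +-monoʳ-≤ t (n≤1+n d)
edgeCount-≤ (odd t d)  3 = subst (suc t ≤_) (≡-sym (+-suc t d)) (s≤s (m≤m+n t d))
edgeCount-≤ (odd t d)  (suc (suc (suc (suc _)))) = z≤n

neighborSum : ∀ {n k} → EdgeColoring n k → (ℕ → ℕ) → Fin n → ℕ
neighborSum c φ v = sum (map (λ u → φ (col c v u)) (nbrs v))

neighborSum-profile : ∀ {k} φ (v : Fin (suc (2 * k))) (cl : VertexClass k (toℕ v)) →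
  neighborSum (coloring k) φ v ≡ profileSum cl φ
neighborSum-profile {k} φ v cl = +-cancelʳ-≡ (φ 2) _ _ (begin
  neighborSum (coloring k) φ v + φ 2
    ≡⟨ cong (λ c → neighborSum (coloring k) φ v + φ c) (≡-sym (edgeColor-double k (toℕ v))) ⟩
  neighborSum (coloring k) φ v + f v
    ≡⟨ sum-nbrs f v ⟩
  sum (tabulate f)
    ≡⟨ cong sum (tabulate-∘toℕ (suc (2 * k)) (λ s → φ (edgeColor k (toℕ v + s)))) ⟩
  windowSum φ k (toℕ v)
    ≡⟨ windowSum-profile φ cl ⟩
  φ 2 + profileSum cl φ
    ≡⟨ +-comm (φ 2) _ ⟩
  profileSum cl φ + φ 2 ∎)
  where
  open ≡-Reasoning
  f : Fin (suc (2 * k)) → ℕ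
  f u = φ (edgeColor k (toℕ v + toℕ u))

vertexClass : ∀ k (v : Fin (suc (2 * k))) → VertexClass k (toℕ v)
vertexClass k v =
  classify k (toℕ v) (subst (toℕ v ≤_) (cong (k +_) (+-identityʳ k)) (toℕ≤pred[n] v))

σ-coloring : ∀ k (v : Fin (suc (2 * k))) → σ (coloring k) v ≡ 3 * k + toℕ v
σ-coloring k v =
  trans (neighborSum-profile (λ x → x) v (vertexClass k v)) (profileSum-id (vertexClass k v))

colorCount-coloring : ∀ k (v : Fin (suc (2 * k))) i →
  colorCount (coloring k) v i ≡ edgeCount (vertexClass k v) i
colorCount-coloring k v i = begin
  colorCount (coloring k) v i
    ≡⟨ length-filter≡sum-indicator (λ u → col (coloring k) v u ≟ℕ i) (nbrs v) ⟩
  neighborSum (coloring k) (indicator i) v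
    ≡⟨ neighborSum-profile (indicator i) v (vertexClass k v) ⟩
  profileSum (vertexClass k v) (indicator i)
    ≡⟨ profileSum-indicator (vertexClass k v) i ⟩
  edgeCount (vertexClass k v) i ∎
  where open ≡-Reasoning

degree-coloring : ∀ k (v : Fin (suc (2 * k))) → degree v ≡ k + k
degree-coloring k v = begin
  degree v                              ≡⟨ ≡-sym (sum-map-const1≡length (nbrs v)) ⟩
  neighborSum (coloring k) (const 1) v  ≡⟨ neighborSum-profile (const 1) v (vertexClass k v) ⟩
  profileSum (vertexClass k v) (const 1) ≡⟨ profileSum-const1 (vertexClass k v) ⟩
  k + k                                 ∎
  where open ≡-Reasoning

coloring-neighborSumDistinguishing : ∀ k → NeighborSumDistinguishing (coloring k)
coloring-neighborSumDistinguishing k u v u≢v σu≡σv = u≢v (toℕ-injective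
  (+-cancelˡ-≡ (3 * k) _ _ (trans (≡-sym (σ-coloring k u)) (trans σu≡σv (σ-coloring k v)))))

coloring-quasiMajority : ∀ k → QuasiMajority (coloring k)
coloring-quasiMajority k v i rewrite degree-coloring k v | ≡-sym (n≡⌈n+n/2⌉ k) =
  subst (_≤ k) (≡-sym (colorCount-coloring k v i)) (edgeCount-≤ (vertexClass k v) i)

alternating : ∀ n → Bool → Subset n
alternating zero    b = []
alternating (suc n) b = b ∷ alternating n (not b)

lookup-alternating : ∀ {n} b (i : Fin n) → lookup (alternating n b) i ≡ iterate not b (toℕ i)
lookup-alternating b fzero    = refl
lookup-alternating b (fsuc i) = lookup-alternating (not b) i

∣alternating-even∣ : ∀ t → ∣ alternating (t + t) true ∣ ≡ t
∣alternating-even∣ zero    = refl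
∣alternating-even∣ (suc t) rewrite +-suc t t = cong suc (∣alternating-even∣ t)

iterate-not-even : ∀ t b → iterate not b (t + t) ≡ b
iterate-not-even zero    b = refl
iterate-not-even (suc t) b rewrite +-suc t t =
  trans (iterate-not-even t (not (not b))) (not-involutive b)

edgeCount-2 : ∀ {k m} (cl : VertexClass k m) →
  edgeCount cl 2 ≡ (if iterate not false m then k ∸ 1 else k)
edgeCount-2 (even t d) rewrite iterate-not-even t false = refl
edgeCount-2 (odd t d)  rewrite iterate-not-even t true | +-suc t d = refl

oddVertices : ∀ k → Subset (suc (2 * k))
oddVertices k = alternating (suc (2 * k)) false

∣oddVertices∣ : ∀ k → ∣ oddVertices k ∣ ≡ k
∣oddVertices∣ k rewrite +-identityʳ k = ∣alternating-even∣ k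

colorCount-2 : ∀ k (v : Fin (suc (2 * k))) →
  colorCount (coloring k) v 2 ≡ (if lookup (oddVertices k) v then k ∸ 1 else k)
colorCount-2 k v = begin
  colorCount (coloring k) v 2
    ≡⟨ colorCount-coloring k v 2 ⟩
  edgeCount (vertexClass k v) 2
    ≡⟨ edgeCount-2 (vertexClass k v) ⟩
  (if iterate not false (toℕ v) then k ∸ 1 else k)
    ≡⟨ cong (if_then k ∸ 1 else k) (≡-sym (lookup-alternating false v)) ⟩
  (if lookup (oddVertices k) v then k ∸ 1 else k) ∎
  where open ≡-Reasoning

colorCount-2-∈ : ∀ k v → v ∈ oddVertices k → colorCount (coloring k) v 2 ≡ k ∸ 1
colorCount-2-∈ k v v∈S rewrite colorCount-2 k v | []=⇒lookup v∈S = refl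

colorCount-2-∉ : ∀ k v → v ∉ oddVertices k → colorCount (coloring k) v 2 ≡ k
colorCount-2-∉ k v v∉S with lookup (oddVertices k) v in eq | colorCount-2 k v
... | true  | _ = ⊥-elim (v∉S (lookup⇒[]= v (oddVertices k) eq))
... | false | count≡k = count≡k

mainTheorem18 : ∀ (k : ℕ) → 1 ≤ k →
    Σ (EdgeColoring (suc (2 * k)) 3) λ c →
    QuasiMajority c × NeighborSumDistinguishing c ×
    Σ (Subset (suc (2 * k))) λ S →
    (∣ S ∣ ≡ k) ×
    (∀ v → v ∈ S → colorCount c v 2 ≡ k ∸ 1) ×
    (∀ v → v ∉ S → colorCount c v 2 ≡ k)
mainTheorem18 k _ =  -- the construction works for k = 0 as well
  coloring k , coloring-quasiMajority k , coloring-neighborSumDistinguishing k ,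
  oddVertices k , ∣oddVertices∣ k , colorCount-2-∈ k , colorCount-2-∉ k
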